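{- Let $n\geq 2k$ and let $\mathcal{T}(n,k)=\{F\in\binom{[n]}{k}\colon |F\cap[3]|\geq 2\}$. Then $\beta(\mathcal{T}(n,k))=\binom{n-4}{k-3}$.
   Context: $\binom{[n]}{k}$ denotes the family of all $k$-element subsets of $[n]=\{1,\dots,n\}$. For a family $\mathcal{F}$ of subsets of $[n]$ and distinct $i,j\in[n]$, let $b_{ij}(\mathcal{F})=|\{F\in\mathcal{F}\colon i\in F,\ j\notin F\}|$; the sturdiness is $\beta(\mathcal{F})=\min_{1\leq i\neq j\leq n} b_{ij}(\mathcal{F})$. -}

module Defs where

open import Data.Nat using (ℕ; zero; suc; _≤_; _<_; _≥_; _∸_; _<?_)
open import Data.Nat.Combinatorics using (_C_)
open import Data.Fin using (Fin; toℕ)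
open import Data.Fin.Subset using (Subset; inside; outside; _∈_; _∉_; _∩_; ∣_∣)
open import Data.Fin.Subset.Properties using (_∈?_)
open import Data.Vec using (Vec; []; _∷_; tabulate)
open import Data.List using (List; []; _∷_; _++_; map; filter; length)
open import Data.Product using (Σ; _×_; _,_)
open import Relation.Nullary using (¬_; Dec; yes; no)
open import Relation.Nullary.Decidable using (_×-dec_; ¬?; ⌊_⌋)
open import Relation.Binary.PropositionalEquality using (_≡_; _≢_)

-- A subset of [n] is a 'Subset n' (Vec Bool n); element i : Fin n stands for i+1 ∈ [n].
-- A family of subsets of [n] is a list of (distinct) subsets.

allSubsets : (n : ℕ) → List (Subset n)
allSubsets zero    = [] ∷ []
allSubsets (suc n) = map (inside ∷_) (allSubsets n) ++ map (outside ∷_) (allSubsets n)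

kSubsets : (n k : ℕ) → List (Subset n)
kSubsets n k = filter (λ F → ∣ F ∣ Data.Nat.≟ k) (allSubsets n)

[3] : (n : ℕ) → Subset n
[3] n = tabulate (λ i → ⌊ toℕ i <? 3 ⌋)

T : (n k : ℕ) → List (Subset n)
T n k = filter (λ F → 2 Data.Nat.≤? ∣ F ∩ [3] n ∣) (kSubsets n k)

b : {n : ℕ} → List (Subset n) → Fin n → Fin n → ℕ
b 𝓕 i j = length (filter (λ F → (i ∈? F) ×-dec ¬? (j ∈? F)) 𝓕)

-- "β(F) = m": m is the minimum of b_ij(F) over ordered pairs i ≠ j
-- (attained by some pair and a lower bound for all pairs)
IsSturdiness : {n : ℕ} → List (Subset n) → ℕ → Set
IsSturdiness {n} 𝓕 m =
  (Σ (Fin n) λ i → Σ (Fin n) λ j → i ≢ j × b 𝓕 i j ≡ m) ×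
  (∀ (i j : Fin n) → i ≢ j → m ≤ b 𝓕 i j)

-- binomial coefficient binom(a, k - 3) with an integer lower index:
-- it is 0 when k - 3 < 0 (i.e. k < 3), and a C (k ∸ 3) otherwise
binomShift3 : ℕ → ℕ → ℕ
binomShift3 a k with k <? 3
... | yes _ = 0
... | no _  = a C (k ∸ 3)

-- For every pair i ≠ j there is a 3-set A with i ∈ A, j ∉ A and |A ∩ [3]| ≥ 2, chosen according
-- to whether i and j lie in [3]. Every k-set containing A and avoiding j lies in T(n,k) and is
-- counted by b_ij, and there are C(n-4, k-3) of them, which gives the lower bound. For i = 4 and
-- j = 1 the bound is attained: a counted set avoids 1 but meets [3] twice, so it contains {2,3,4}
-- (and there is none when k < 3).
--
-- Both counts are instances of one formula: a pattern prescribing some elements as required,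
-- some as forbidden and leaving f elements free is matched by exactly C(f, r) sets of size
-- (number of required elements) + r, by induction on n with Pascal's rule.
module Submission where

open import Defs
open import Data.Bool using (Bool; true; false)
open import Data.Fin using (Fin; zero; suc; _↑ˡ_; _↑ʳ_)
open import Data.Fin.Subset using (Subset; inside; outside; ∣_∣; _∈_; _∉_; _∩_; ⊤; ⊥)
open import Data.Fin.Subset.Properties
  using (_∈?_; ∣p∣≤∣x∷p∣; ∩-zeroʳ; ∣⊥∣≡0; p⊆q⇒∣p∣≤∣q∣; p∩q⊆p)
open import Data.List as List using (List; []; _∷_; map; filter; length)
open import Data.List.Properties using (length-++; filter-++; filter-≐)
open import Data.Nat using (ℕ; zero; suc; _+_; _*_; _∸_; _≤_; _<_; z≤n; s≤s; _≟_; _≤?_)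
open import Data.Nat.Properties
  using ( ≤-trans; ≤-reflexive; ≤-antisym; m≤n⇒m≤1+n; <⇒≱; *-monoʳ-≤; m+[n∸m]≡n
        ; suc-injective; +-suc; +-identityʳ; module ≤-Reasoning)
open import Data.Nat.Combinatorics using (_C_; nCk+nC[k+1]≡[n+1]C[k+1])
open import Data.Product using (_×_; _,_)
open import Data.Vec using (Vec; []; _∷_; here; there; _++_; replicate; lookup; _[_]≔_)
open import Data.Vec.Properties
  using ( lookup∘updateAt; lookup∘updateAt′; lookup-replicate; lookup-++ˡ; lookup-++ʳ
        ; lookup⇒[]=; []=⇒lookup; tabulate-cong; tabulate∘lookup)
open import Data.Vec.Relation.Binary.Pointwise.Inductive as Pointwise using (Pointwise; []; _∷_)
open import Function using (_∘_)
open import Level using (Level)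
open import Relation.Nullary using (Dec; yes; no; ¬_; ¬?; _×-dec_; contradiction)
open import Relation.Unary using (Pred; Decidable)
open import Relation.Binary.PropositionalEquality
  using (_≡_; _≢_; refl; sym; trans; cong; cong₂; subst; module ≡-Reasoning)

private
  variable
    a ℓ ℓ′ : Level
    A B : Set a
    n : ℕ

module _ {P : Pred A ℓ} (P? : Decidable P) where

  length-filter-none : (∀ {x} → ¬ P x) → ∀ xs → length (filter P? xs) ≡ 0
  length-filter-none ¬P []       = refl
  length-filter-none ¬P (x ∷ xs) with P? x
  ... | yes Px = contradiction Px ¬P
  ... | no _   = length-filter-none ¬P xs

  length-filter-map : ∀ (f : B → A) xs → length (filter P? (map f xs)) ≡ length (filter (P? ∘ f) xs)
  length-filter-map f []       = refl
  length-filter-map f (x ∷ xs) with P? (f x)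
  ... | yes _ = cong suc (length-filter-map f xs)
  ... | no _  = length-filter-map f xs

module _ {P : Pred A ℓ} {Q : Pred A ℓ′} (P? : Decidable P) (Q? : Decidable Q) where

  length-filter-mono : (∀ {x} → P x → Q x) → ∀ xs → length (filter P? xs) ≤ length (filter Q? xs)
  length-filter-mono P⇒Q []       = z≤n
  length-filter-mono P⇒Q (x ∷ xs) with P? x | Q? x
  ... | yes Px | no ¬Qx = contradiction (P⇒Q Px) ¬Qx
  ... | yes _  | yes _  = s≤s (length-filter-mono P⇒Q xs)
  ... | no _   | yes _  = m≤n⇒m≤1+n (length-filter-mono P⇒Q xs)
  ... | no _   | no _   = length-filter-mono P⇒Q xs

  length-filter-cong : (∀ {x} → P x → Q x) → (∀ {x} → Q x → P x) →
                       ∀ xs → length (filter P? xs) ≡ length (filter Q? xs)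
  length-filter-cong P⇒Q Q⇒P xs = cong length (filter-≐ P? Q? (P⇒Q , Q⇒P) xs)

  filter-filter : ∀ xs → filter Q? (filter P? xs) ≡ filter (λ x → P? x ×-dec Q? x) xs
  filter-filter []       = refl
  filter-filter (x ∷ xs) with P? x
  ... | no _  = filter-filter xs
  ... | yes _ with Q? x
  ...   | yes _ = cong (x ∷_) (filter-filter xs)
  ...   | no _  = filter-filter xs

#⟨_⟩ : {P : Pred (Subset n) ℓ} → Decidable P → ℕ
#⟨ P? ⟩ = length (filter P? (allSubsets _))

#⟨⟩-split : ∀ {P : Pred (Subset (suc n)) ℓ} (P? : Decidable P) →
            #⟨ P? ⟩ ≡ #⟨ P? ∘ (inside ∷_) ⟩ + #⟨ P? ∘ (outside ∷_) ⟩
#⟨⟩-split {n} P? = begin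
  length (filter P? (insides List.++ outsides))            ≡⟨ cong length (filter-++ P? insides outsides) ⟩
  length (filter P? insides List.++ filter P? outsides)    ≡⟨ length-++ (filter P? insides) ⟩
  length (filter P? insides) + length (filter P? outsides) ≡⟨ cong₂ _+_ (length-filter-map P? (inside ∷_) subsets)
                                                                         (length-filter-map P? (outside ∷_) subsets) ⟩
  #⟨ P? ∘ (inside ∷_) ⟩ + #⟨ P? ∘ (outside ∷_) ⟩           ∎
  where
  open ≡-Reasoning
  subsets  = allSubsets n
  insides  = map (inside ∷_) subsets
  outsides = map (outside ∷_) subsets

-- Patterns

data Constraint : Set where
  required forbidden free : Constraint

data Admits : Constraint → Bool → Set where
  required  : Admits required true
  forbidden : Admits forbidden false
  free      : ∀ {x} → Admits free x

admits? : ∀ c x → Dec (Admits c x)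
admits? required  true  = yes required
admits? required  false = no λ ()
admits? forbidden true  = no λ ()
admits? forbidden false = yes forbidden
admits? free      _     = yes free

Pattern : ℕ → Set
Pattern = Vec Constraint

Matches : Pattern n → Subset n → Set
Matches = Pointwise Admits

#required : Pattern n → ℕ
#required []              = 0
#required (required ∷ p)  = suc (#required p)
#required (forbidden ∷ p) = #required p
#required (free ∷ p)      = #required p

#free : Pattern n → ℕ
#free []              = 0
#free (required ∷ p)  = #free p
#free (forbidden ∷ p) = #free p
#free (free ∷ p)      = suc (#free p)

#required≤∣_∣ : ∀ {p : Pattern n} {F} → Matches p F → #required p ≤ ∣ F ∣
#required≤∣ []             ∣ = z≤n
#required≤∣ required ∷ ps  ∣ = s≤s #required≤∣ ps ∣
#required≤∣ forbidden ∷ ps ∣ = #required≤∣ ps ∣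
#required≤∣_∣ {F = x ∷ F} (free ∷ ps) = ≤-trans #required≤∣ ps ∣ (∣p∣≤∣x∷p∣ x F)

Fits : Pattern n → ℕ → Pred (Subset n) _
Fits p k F = ∣ F ∣ ≡ k × Matches p F

fits? : (p : Pattern n) (k : ℕ) → Decidable (Fits p k)
fits? p k F = (∣ F ∣ ≟ k) ×-dec Pointwise.decidable admits? p F

count-fits : ∀ (p : Pattern n) r → #⟨ fits? p (#required p + r) ⟩ ≡ #free p C r
count-fits []      zero    = refl
count-fits []      (suc r) = refl
count-fits {suc n} (required ∷ p) r = begin
  #⟨ P? ⟩                                        ≡⟨ #⟨⟩-split P? ⟩
  #⟨ P? ∘ (inside ∷_) ⟩ + #⟨ P? ∘ (outside ∷_) ⟩ ≡⟨ cong₂ _+_ inside-part outside-part ⟩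
  #⟨ fits? p k ⟩ + 0                             ≡⟨ cong (_+ 0) (count-fits p r) ⟩
  #free p C r + 0                                ≡⟨ +-identityʳ _ ⟩
  #free p C r                                    ∎
  where
  open ≡-Reasoning
  k  = #required p + r
  P? = fits? (required ∷ p) (suc k)
  inside-part : #⟨ P? ∘ (inside ∷_) ⟩ ≡ #⟨ fits? p k ⟩
  inside-part = length-filter-cong (P? ∘ (inside ∷_)) (fits? p k)
    (λ { (e , required ∷ ps) → suc-injective e , ps })
    (λ { (e , ps) → cong suc e , required ∷ ps }) (allSubsets n)
  outside-part : #⟨ P? ∘ (outside ∷_) ⟩ ≡ 0
  outside-part = length-filter-none (P? ∘ (outside ∷_)) (λ { (_ , () ∷ _) }) (allSubsets n)
count-fits {suc n} (forbidden ∷ p) r = begin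
  #⟨ P? ⟩                                        ≡⟨ #⟨⟩-split P? ⟩
  #⟨ P? ∘ (inside ∷_) ⟩ + #⟨ P? ∘ (outside ∷_) ⟩ ≡⟨ cong₂ _+_ inside-part outside-part ⟩
  #⟨ fits? p k ⟩                                 ≡⟨ count-fits p r ⟩
  #free p C r                                    ∎
  where
  open ≡-Reasoning
  k  = #required p + r
  P? = fits? (forbidden ∷ p) k
  inside-part : #⟨ P? ∘ (inside ∷_) ⟩ ≡ 0
  inside-part = length-filter-none (P? ∘ (inside ∷_)) (λ { (_ , () ∷ _) }) (allSubsets n)
  outside-part : #⟨ P? ∘ (outside ∷_) ⟩ ≡ #⟨ fits? p k ⟩
  outside-part = length-filter-cong (P? ∘ (outside ∷_)) (fits? p k)
    (λ { (e , forbidden ∷ ps) → e , ps }) (λ { (e , ps) → e , forbidden ∷ ps }) (allSubsets n)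
count-fits {suc n} (free ∷ p) zero = begin
  #⟨ P? ⟩                                        ≡⟨ #⟨⟩-split P? ⟩
  #⟨ P? ∘ (inside ∷_) ⟩ + #⟨ P? ∘ (outside ∷_) ⟩ ≡⟨ cong₂ _+_ inside-part outside-part ⟩
  #⟨ fits? p k ⟩                                 ≡⟨ count-fits p 0 ⟩
  #free p C 0                                    ≡⟨⟩
  suc (#free p) C 0                              ∎
  where
  open ≡-Reasoning
  k  = #required p + 0
  P? = fits? (free ∷ p) k
  inside-part : #⟨ P? ∘ (inside ∷_) ⟩ ≡ 0
  inside-part = length-filter-none (P? ∘ (inside ∷_))
    (λ { (e , _ ∷ ps) → <⇒≱ (≤-reflexive (trans e (+-identityʳ _))) #required≤∣ ps ∣ }) (allSubsets n)
  outside-part : #⟨ P? ∘ (outside ∷_) ⟩ ≡ #⟨ fits? p k ⟩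
  outside-part = length-filter-cong (P? ∘ (outside ∷_)) (fits? p k)
    (λ { (e , _ ∷ ps) → e , ps }) (λ { (e , ps) → e , free ∷ ps }) (allSubsets n)
count-fits {suc n} (free ∷ p) (suc r) = begin
  #⟨ P? ⟩                                        ≡⟨ #⟨⟩-split P? ⟩
  #⟨ P? ∘ (inside ∷_) ⟩ + #⟨ P? ∘ (outside ∷_) ⟩ ≡⟨ cong₂ _+_ inside-part outside-part ⟩
  #⟨ fits? p k ⟩ + #⟨ fits? p (#required p + suc r) ⟩ ≡⟨ cong₂ _+_ (count-fits p r) (count-fits p (suc r)) ⟩
  #free p C r + #free p C suc r                  ≡⟨ nCk+nC[k+1]≡[n+1]C[k+1] (#free p) r ⟩
  suc (#free p) C suc r                          ∎
  where
  open ≡-Reasoning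
  k  = #required p + r
  P? = fits? (free ∷ p) (#required p + suc r)
  inside-part : #⟨ P? ∘ (inside ∷_) ⟩ ≡ #⟨ fits? p k ⟩
  inside-part = length-filter-cong (P? ∘ (inside ∷_)) (fits? p k)
    (λ { (e , _ ∷ ps) → suc-injective (trans e (+-suc _ r)) , ps })
    (λ { (e , ps) → trans (cong suc e) (sym (+-suc _ r)) , free ∷ ps }) (allSubsets n)
  outside-part : #⟨ P? ∘ (outside ∷_) ⟩ ≡ #⟨ fits? p (#required p + suc r) ⟩
  outside-part = length-filter-cong (P? ∘ (outside ∷_)) (fits? p (#required p + suc r))
    (λ { (e , _ ∷ ps) → e , ps }) (λ { (e , ps) → e , free ∷ ps }) (allSubsets n)

count-fits-below : ∀ (p : Pattern n) {k} → k < #required p → #⟨ fits? p k ⟩ ≡ 0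
count-fits-below p k<p =
  length-filter-none (fits? p _) (λ { (refl , ps) → <⇒≱ k<p #required≤∣ ps ∣ }) (allSubsets _)

#⟨fits⟩≡C : ∀ (p : Pattern n) {a f} → #required p ≡ a → #free p ≡ f →
            ∀ r → #⟨ fits? p (a + r) ⟩ ≡ f C r
#⟨fits⟩≡C p refl refl = count-fits p

#required-++ : ∀ {m} (p : Pattern m) (q : Pattern n) → #required (p ++ q) ≡ #required p + #required q
#required-++ []              q = refl
#required-++ (required ∷ p)  q = cong suc (#required-++ p q)
#required-++ (forbidden ∷ p) q = #required-++ p q
#required-++ (free ∷ p)      q = #required-++ p q

#free-++ : ∀ {m} (p : Pattern m) (q : Pattern n) → #free (p ++ q) ≡ #free p + #free q
#free-++ []              q = refl
#free-++ (required ∷ p)  q = #free-++ p q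
#free-++ (forbidden ∷ p) q = #free-++ p q
#free-++ (free ∷ p)      q = cong suc (#free-++ p q)

#required-replicate : ∀ n → #required (replicate n free) ≡ 0
#required-replicate zero    = refl
#required-replicate (suc n) = #required-replicate n

#free-replicate : ∀ n → #free (replicate n free) ≡ n
#free-replicate zero    = refl
#free-replicate (suc n) = cong suc (#free-replicate n)

matches-free : (F : Subset n) → Matches (replicate n free) F
matches-free []      = []
matches-free (_ ∷ F) = free ∷ matches-free F

required⇒∈ : ∀ {p : Pattern n} {F} → Matches p F → ∀ x → lookup p x ≡ required → x ∈ F
required⇒∈ {F = F} ps x eq = lookup⇒[]= x F (inside-if-required (Pointwise.lookup ps x) eq)
  where
  inside-if-required : ∀ {c b} → Admits c b → c ≡ required → b ≡ inside
  inside-if-required required refl = refl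

forbidden⇒∉ : ∀ {p : Pattern n} {F} → Matches p F → ∀ x → lookup p x ≡ forbidden → x ∉ F
forbidden⇒∉ ps x eq x∈F = outside-if-forbidden (Pointwise.lookup ps x) eq ([]=⇒lookup x∈F)
  where
  outside-if-forbidden : ∀ {c b} → Admits c b → c ≡ forbidden → b ≢ inside
  outside-if-forbidden forbidden refl ()

mark : Constraint → Fin n → Pattern n
mark c x = replicate _ free [ x ]≔ c

lookup-mark : ∀ c (x : Fin n) → lookup (mark c x) x ≡ c
lookup-mark c x = lookup∘updateAt x (replicate _ free)

#required-mark : ∀ c (x : Fin n) → #required (mark c x) ≡ #required (c ∷ [])
#required-mark {suc n} required  zero    = cong suc (#required-replicate n)
#required-mark {suc n} forbidden zero    = #required-replicate n
#required-mark {suc n} free      zero    = #required-replicate n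
#required-mark         c         (suc x) = #required-mark c x

#free-mark : ∀ c (x : Fin (suc n)) → #free (mark c x) ≡ #free (c ∷ []) + n
#free-mark {n}     required  zero    = #free-replicate n
#free-mark {n}     forbidden zero    = #free-replicate n
#free-mark {n}     free      zero    = cong suc (#free-replicate n)
#free-mark {suc n} c         (suc x) = trans (cong suc (#free-mark c x)) (sym (+-suc _ n))

mark₂ : Fin n → Fin n → Pattern n
mark₂ i j = mark required i [ j ]≔ forbidden

lookup-mark₂ˡ : ∀ {i j : Fin n} → i ≢ j → lookup (mark₂ i j) i ≡ required
lookup-mark₂ˡ {i = i} {j} i≢j = trans (lookup∘updateAt′ i j i≢j (mark required i)) (lookup-mark required i)

lookup-mark₂ʳ : ∀ (i j : Fin n) → lookup (mark₂ i j) j ≡ forbidden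
lookup-mark₂ʳ i j = lookup∘updateAt j (mark required i)

#required-mark₂ : (i j : Fin n) → i ≢ j → #required (mark₂ i j) ≡ 1
#required-mark₂ zero    zero    i≢j = contradiction refl i≢j
#required-mark₂ zero    (suc j) _   = cong suc (#required-mark forbidden j)
#required-mark₂ (suc i) zero    _   = #required-mark required i
#required-mark₂ (suc i) (suc j) i≢j = #required-mark₂ i j (i≢j ∘ cong suc)

#free-mark₂ : (i j : Fin n) → i ≢ j → 2 + #free (mark₂ i j) ≡ n
#free-mark₂               zero    zero    i≢j = contradiction refl i≢j
#free-mark₂ {suc (suc n)} zero    (suc j) _   = cong (2 +_) (#free-mark forbidden j)
#free-mark₂ {suc (suc n)} (suc i) zero    _   = cong (2 +_) (#free-mark required i)
#free-mark₂ {suc n}       (suc i) (suc j) i≢j = cong suc (#free-mark₂ i j (i≢j ∘ cong suc))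

forbid : Fin 3 → Pattern 3
forbid y = replicate 3 required [ y ]≔ forbidden

lookup-forbidˡ : ∀ {x y} → x ≢ y → lookup (forbid y) x ≡ required
lookup-forbidˡ {x} {y} x≢y =
  trans (lookup∘updateAt′ x y x≢y (replicate 3 required)) (lookup-replicate x required)

lookup-forbidʳ : ∀ y → lookup (forbid y) y ≡ forbidden
lookup-forbidʳ y = lookup∘updateAt y (replicate 3 required)

#required-forbid : ∀ y → #required (forbid y) ≡ 2
#required-forbid zero             = refl
#required-forbid (suc zero)       = refl
#required-forbid (suc (suc zero)) = refl

#free-forbid : ∀ y → #free (forbid y) ≡ 0
#free-forbid zero             = refl
#free-forbid (suc zero)       = refl
#free-forbid (suc (suc zero)) = refl

∣p++q∩⊤++⊥∣≡∣p∣ : ∀ {m} (p : Subset m) (q : Subset n) → ∣ (p ++ q) ∩ (⊤ {m} ++ ⊥ {n}) ∣ ≡ ∣ p ∣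
∣p++q∩⊤++⊥∣≡∣p∣ {n} []            q = trans (cong ∣_∣ (∩-zeroʳ q)) (∣⊥∣≡0 n)
∣p++q∩⊤++⊥∣≡∣p∣     (inside ∷ p)  q = cong suc (∣p++q∩⊤++⊥∣≡∣p∣ p q)
∣p++q∩⊤++⊥∣≡∣p∣     (outside ∷ p) q = ∣p++q∩⊤++⊥∣≡∣p∣ p q

[3]≡⊤++⊥ : ∀ n → [3] (3 + n) ≡ ⊤ {3} ++ ⊥ {n}
[3]≡⊤++⊥ n = cong (λ s → inside ∷ inside ∷ inside ∷ s)
  (trans (tabulate-cong (λ i → sym (lookup-replicate i outside))) (tabulate∘lookup ⊥))

∣∩[3]∣ : ∀ (p : Subset 3) (q : Subset n) → ∣ (p ++ q) ∩ [3] (3 + n) ∣ ≡ ∣ p ∣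
∣∩[3]∣ {n} p q =
  trans (cong (λ s → ∣ (p ++ q) ∩ s ∣) ([3]≡⊤++⊥ n)) (∣p++q∩⊤++⊥∣≡∣p∣ p q)

data Side (m : ℕ) : Fin (3 + m) → Set where
  inside-[3]  : (x : Fin 3) → Side m (x ↑ˡ m)
  outside-[3] : (y : Fin m) → Side m (3 ↑ʳ y)

side : ∀ {m} (x : Fin (3 + m)) → Side m x
side zero                = inside-[3] zero
side (suc zero)          = inside-[3] (suc zero)
side (suc (suc zero))    = inside-[3] (suc (suc zero))
side (suc (suc (suc y))) = outside-[3] y

Contributes : ℕ → Fin n → Fin n → Pred (Subset n) _
Contributes {n} k i j F = (∣ F ∣ ≡ k × 2 ≤ ∣ F ∩ [3] n ∣) × (i ∈ F × j ∉ F)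

contributes? : ∀ k (i j : Fin n) → Decidable (Contributes k i j)
contributes? k i j F = ((∣ F ∣ ≟ k) ×-dec (2 ≤? ∣ F ∩ [3] _ ∣)) ×-dec ((i ∈? F) ×-dec ¬? (j ∈? F))

b-T≡#⟨contributes⟩ : ∀ n k (i j : Fin n) → b (T n k) i j ≡ #⟨ contributes? k i j ⟩
b-T≡#⟨contributes⟩ n k i j = trans (cong (length ∘ filter _) (filter-filter _ _ (allSubsets n)))
                                   (cong length (filter-filter _ _ (allSubsets n)))

b-T≡0 : ∀ {k} → k ≤ 1 → (i j : Fin n) → b (T n k) i j ≡ 0
b-T≡0 {n} {k} k≤1 i j =
  trans (b-T≡#⟨contributes⟩ n k i j) (length-filter-none (contributes? k i j) too-small (allSubsets n))
  where
  too-small : ∀ {F} → ¬ Contributes k i j F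
  too-small {F} ((∣F∣≡k , 2≤∣F∩[3]∣) , _) = <⇒≱ (s≤s k≤1) (begin
    2               ≤⟨ 2≤∣F∩[3]∣ ⟩
    ∣ F ∩ [3] n ∣   ≤⟨ p⊆q⇒∣p∣≤∣q∣ (p∩q⊆p F ([3] n)) ⟩
    ∣ F ∣           ≡⟨ ∣F∣≡k ⟩
    k               ∎)
    where open ≤-Reasoning

-- Lower bound

record Certificate (m : ℕ) (i j : Fin (4 + m)) : Set where
  field
    prefix          : Pattern 3
    suffix          : Pattern (suc m)
    prefix-required : 2 ≤ #required prefix
    #required≡3     : #required prefix + #required suffix ≡ 3
    #free≡m         : #free prefix + #free suffix ≡ m
    i-required      : lookup (prefix ++ suffix) i ≡ required
    j-forbidden     : lookup (prefix ++ suffix) j ≡ forbidden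

module _ {m : ℕ} where

  certificate-inside-inside : ∀ {x y} → x ≢ y → Certificate m (x ↑ˡ suc m) (y ↑ˡ suc m)
  certificate-inside-inside {x} {y} x≢y = record
    { prefix          = forbid y
    ; suffix          = required ∷ replicate m free
    ; prefix-required = ≤-reflexive (sym (#required-forbid y))
    ; #required≡3     = cong₂ _+_ (#required-forbid y) (cong suc (#required-replicate m))
    ; #free≡m         = cong₂ _+_ (#free-forbid y) (#free-replicate m)
    ; i-required      = trans (lookup-++ˡ (forbid y) (required ∷ replicate m free) x) (lookup-forbidˡ x≢y)
    ; j-forbidden     = trans (lookup-++ˡ (forbid y) (required ∷ replicate m free) y) (lookup-forbidʳ y)
    }

  certificate-inside-outside : ∀ x y → Certificate m (x ↑ˡ suc m) (3 ↑ʳ y)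
  certificate-inside-outside x y = record
    { prefix          = replicate 3 required
    ; suffix          = mark forbidden y
    ; prefix-required = s≤s (s≤s z≤n)
    ; #required≡3     = cong (3 +_) (#required-mark forbidden y)
    ; #free≡m         = #free-mark forbidden y
    ; i-required      = trans (lookup-++ˡ (replicate 3 required) (mark forbidden y) x) (lookup-replicate x required)
    ; j-forbidden     = trans (lookup-++ʳ (replicate 3 required) (mark forbidden y) y) (lookup-mark forbidden y)
    }

  certificate-outside-inside : ∀ x y → Certificate m (3 ↑ʳ x) (y ↑ˡ suc m)
  certificate-outside-inside x y = record
    { prefix          = forbid y
    ; suffix          = mark required x
    ; prefix-required = ≤-reflexive (sym (#required-forbid y))
    ; #required≡3     = cong₂ _+_ (#required-forbid y) (#required-mark required x)
    ; #free≡m         = cong₂ _+_ (#free-forbid y) (#free-mark required x)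
    ; i-required      = trans (lookup-++ʳ (forbid y) (mark required x) x) (lookup-mark required x)
    ; j-forbidden     = trans (lookup-++ˡ (forbid y) (mark required x) y) (lookup-forbidʳ y)
    }

  certificate-outside-outside : ∀ {x y} → x ≢ y → Certificate m (3 ↑ʳ x) (3 ↑ʳ y)
  certificate-outside-outside {x} {y} x≢y = record
    { prefix          = prefix
    ; suffix          = mark₂ x y
    ; prefix-required = s≤s (s≤s z≤n)
    ; #required≡3     = cong (2 +_) (#required-mark₂ x y x≢y)
    ; #free≡m         = suc-injective (#free-mark₂ x y x≢y)
    ; i-required      = trans (lookup-++ʳ prefix (mark₂ x y) x) (lookup-mark₂ˡ x≢y)
    ; j-forbidden     = trans (lookup-++ʳ prefix (mark₂ x y) y) (lookup-mark₂ʳ x y)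
    }
    where prefix = required ∷ required ∷ free ∷ []

certificate : ∀ {m} (i j : Fin (4 + m)) → i ≢ j → Certificate m i j
certificate i j i≢j with side i | side j
... | inside-[3] x  | inside-[3] y  = certificate-inside-inside (i≢j ∘ cong (_↑ˡ _))
... | inside-[3] x  | outside-[3] y = certificate-inside-outside x y
... | outside-[3] x | inside-[3] y  = certificate-outside-inside x y
... | outside-[3] x | outside-[3] y = certificate-outside-outside (i≢j ∘ cong (3 ↑ʳ_))

module _ {m} {i j : Fin (4 + m)} (cert : Certificate m i j) where
  open Certificate cert

  fits⇒contributes : ∀ {k F} → Fits (prefix ++ suffix) k F → Contributes k i j F
  fits⇒contributes {F = x ∷ y ∷ z ∷ R} (∣F∣≡k , ps) =
    (∣F∣≡k , 2≤∣F∩[3]∣) , required⇒∈ ps i i-required , forbidden⇒∉ ps j j-forbidden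
    where
    2≤∣F∩[3]∣ : 2 ≤ ∣ (x ∷ y ∷ z ∷ R) ∩ [3] (4 + m) ∣
    2≤∣F∩[3]∣ = begin
      2                               ≤⟨ prefix-required ⟩
      #required prefix                ≤⟨ #required≤∣ Pointwise.++ˡ⁻ prefix (x ∷ y ∷ z ∷ []) ps ∣ ⟩
      ∣ x ∷ y ∷ z ∷ [] ∣              ≡⟨ ∣∩[3]∣ (x ∷ y ∷ z ∷ []) R ⟨
      ∣ (x ∷ y ∷ z ∷ R) ∩ [3] (4 + m) ∣ ∎
      where open ≤-Reasoning

  certified-lower-bound : ∀ r → m C r ≤ b (T (4 + m) (3 + r)) i j
  certified-lower-bound r = begin
    m C r                                 ≡⟨ #⟨fits⟩≡C (prefix ++ suffix) #required≡3′ #free≡m′ r ⟨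
    #⟨ fits? (prefix ++ suffix) (3 + r) ⟩ ≤⟨ length-filter-mono (fits? _ _) (contributes? _ i j)
                                                                fits⇒contributes (allSubsets _) ⟩
    #⟨ contributes? (3 + r) i j ⟩         ≡⟨ b-T≡#⟨contributes⟩ (4 + m) (3 + r) i j ⟨
    b (T (4 + m) (3 + r)) i j             ∎
    where
    open ≤-Reasoning
    #required≡3′ = trans (#required-++ prefix suffix) #required≡3
    #free≡m′     = trans (#free-++ prefix suffix) #free≡m

lower-bound : ∀ {m} r (i j : Fin (4 + m)) → i ≢ j → m C r ≤ b (T (4 + m) (3 + r)) i j
lower-bound r i j i≢j = certified-lower-bound (certificate i j i≢j) r

-- Attaining the bound

module _ {m : ℕ} where

  -- Indices are 0-based: 3 ↑ʳ zero is the element 4 of the paper and zero is the element 1.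
  witness : Pattern (4 + m)
  witness = forbidden ∷ required ∷ required ∷ required ∷ replicate m free

  #required-witness : #required witness ≡ 3
  #required-witness = cong (3 +_) (#required-replicate m)

  both-inside : ∀ x y → 2 ≤ ∣ outside ∷ x ∷ y ∷ [] ∣ →
                Matches (required ∷ required ∷ []) (x ∷ y ∷ [])
  both-inside inside  inside  _        = required ∷ required ∷ []
  both-inside inside  outside (s≤s ())
  both-inside outside inside  (s≤s ())
  both-inside outside outside ()

  contributes⇒fits-witness : ∀ {k} {F : Subset (4 + m)} → Contributes k (3 ↑ʳ zero) zero F → Fits witness k F
  contributes⇒fits-witness {F = inside ∷ _} (_ , _ , 0∉F) = contradiction here 0∉F
  contributes⇒fits-witness {F = outside ∷ x ∷ y ∷ _ ∷ R}
                           ((∣F∣≡k , 2≤∣F∩[3]∣) , there (there (there here)) , _) =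
    ∣F∣≡k , forbidden ∷ Pointwise.++⁺ (both-inside x y 2≤∣outside∷x∷y∣) (required ∷ matches-free R)
    where
    2≤∣outside∷x∷y∣ : 2 ≤ ∣ outside ∷ x ∷ y ∷ [] ∣
    2≤∣outside∷x∷y∣ = ≤-trans 2≤∣F∩[3]∣ (≤-reflexive (∣∩[3]∣ (outside ∷ x ∷ y ∷ []) (inside ∷ R)))

  b-T≤#⟨fits-witness⟩ : ∀ k → b (T (4 + m) k) (3 ↑ʳ zero) zero ≤ #⟨ fits? witness k ⟩
  b-T≤#⟨fits-witness⟩ k = ≤-trans (≤-reflexive (b-T≡#⟨contributes⟩ (4 + m) k _ _))
    (length-filter-mono (contributes? k _ _) (fits? witness k) contributes⇒fits-witness (allSubsets _))

  upper-bound₂ : b (T (4 + m) 2) (3 ↑ʳ zero) zero ≤ 0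
  upper-bound₂ = ≤-trans (b-T≤#⟨fits-witness⟩ 2)
    (≤-reflexive (count-fits-below witness (≤-reflexive (sym #required-witness))))

  upper-bound : ∀ r → b (T (4 + m) (3 + r)) (3 ↑ʳ zero) zero ≤ m C r
  upper-bound r = ≤-trans (b-T≤#⟨fits-witness⟩ (3 + r))
    (≤-reflexive (#⟨fits⟩≡C witness #required-witness (#free-replicate m) r))

sturdiness-from-bounds : ∀ (𝓕 : List (Subset n)) {β} i j → i ≢ j → b 𝓕 i j ≤ β →
                         (∀ i j → i ≢ j → β ≤ b 𝓕 i j) → IsSturdiness 𝓕 β
sturdiness-from-bounds _ i j i≢j upper lower = (i , j , i≢j , ≤-antisym upper (lower i j i≢j)) , lower

sturdiness-k≤1 : ∀ n k → 2 ≤ n → k ≤ 1 → IsSturdiness (T n k) 0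
sturdiness-k≤1 (suc zero)    _ (s≤s ()) _
sturdiness-k≤1 (suc (suc n)) k _        k≤1 =
  sturdiness-from-bounds (T (2 + n) k) zero (suc zero) (λ ())
    (≤-reflexive (b-T≡0 {2 + n} k≤1 zero (suc zero))) (λ _ _ _ → z≤n)

sturdiness-k≥2 : ∀ m k → IsSturdiness (T (4 + m) (2 + k)) (binomShift3 m (2 + k))
sturdiness-k≥2 m zero    =
  sturdiness-from-bounds (T (4 + m) 2) (3 ↑ʳ zero) zero (λ ()) (upper-bound₂ {m}) (λ _ _ _ → z≤n)
sturdiness-k≥2 m (suc r) =
  sturdiness-from-bounds (T (4 + m) (3 + r)) (3 ↑ʳ zero) zero (λ ()) (upper-bound {m} r) (lower-bound r)

claim1p6 : ∀ (n k : ℕ) → 2 * k ≤ n → 2 ≤ n → IsSturdiness (T n k) (binomShift3 (n ∸ 4) k)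
claim1p6 n 0             _    2≤n = sturdiness-k≤1 n 0 2≤n z≤n
claim1p6 n 1             _    2≤n = sturdiness-k≤1 n 1 2≤n (s≤s z≤n)
claim1p6 n (suc (suc k)) 2k≤n _   =
  subst (λ n → IsSturdiness (T n (2 + k)) (binomShift3 (n ∸ 4) (2 + k)))
        (m+[n∸m]≡n 4≤n) (sturdiness-k≥2 (n ∸ 4) k)
  where
  4≤n : 4 ≤ n
  4≤n = ≤-trans (*-monoʳ-≤ 2 (s≤s (s≤s z≤n))) 2k≤n
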